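{- Let $(m)$ and $(m')$ be two frieze patterns of type $D_N$ and let $\Sigma$ be a slice. If $m_D=m'_D$ for every arc $D\in\Sigma$, then $m_D=m'_D$ for every arc $D$ of $S_\odot$ (that is, the entries of a frieze pattern of type $D_N$ on a slice determine the entire pattern).
   Context: $S_\odot$ is a disc with $N\ge 3$ marked boundary points $1,\dots,N$ (clockwise, indices mod $N$) and a puncture $0$. Its arcs (up to isotopy) are: for boundary vertices $i,j$ with $j\neq i+1$ (possibly $j=i$), the arc $D_{ij}$ from $i$ to $j$ which together with the clockwise boundary path from $i$ to $j$ bounds a disc not containing the puncture ($D_{ii}$ is the loop at $i$ around the puncture), and the central arcs $D_{i0}$. A frieze pattern of type $D_N$ is an assignment of positive integers $m_{ij}$ to the arcs $D_{ij}$ and $m_{i0}$ to the arcs $D_{i0}$ such that, with $m_{i,i+1}:=1$ and indices mod $N$, for all boundary vertices $i,j$: (R1) $m_{ij}m_{i+1,j+1}=m_{i+1,j}m_{i,j+1}+1$ whenever $j\notin\{i-1,i,i+1\}$; (R2) $m_{i,i-1}m_{i+1,i}=m_{i+1,i-1}m_{ii}m_{i0}+1$; (R3) $m_{ii}m_{i+1,0}=m_{i+1,i}+1$; (R4) $m_{i0}m_{i+1,i+1}=m_{i+1,i}+1$. (The paper displays these numbers in an array whose $k$-th row, $1\le k\le N-2$, consists of the $m_{p,p+k+1}$, followed by two rows containing the $m_{ii}$ and $m_{i0}$.) A slice is a set $\Sigma=\{E_1,\dots,E_N\}$ of arcs of the following form (this is the paper's definition of a slice, expressed in terms of arcs): $E_1=D_{a,a+2}$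 for some boundary vertex $a$; for $2\le k\le N-2$, if $E_{k-1}=D_{p,q}$ then $E_k\in\{D_{p,q+1},D_{p-1,q}\}$ (so $E_{N-2}=D_{i,i-1}$ for some $i$); and $\{E_{N-1},E_N\}$ is one of $\{D_{i0},D_{ii}\}$, $\{D_{i-1,0},D_{i-1,i-1}\}$, $\{D_{i0},D_{i-1,0}\}$, $\{D_{ii},D_{i-1,i-1}\}$. -}

module Defs where

open import Data.Nat using (ℕ; zero; suc; _+_; _*_; _<_)
open import Data.Nat.DivMod using (_mod_)
open import Data.Fin using (Fin; toℕ; inject₁; fromℕ)
import Data.Fin as F
open import Data.Product using (Σ; _×_; _,_)
open import Data.Sum using (_⊎_)
open import Relation.Binary.PropositionalEquality using (_≡_; _≢_)

-- Throughout, the number of boundary points is N = 3 + n (so N ≥ 3),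
-- boundary vertices are Fin N (vertex k of the paper is k-1 here),
-- and arithmetic on vertices is mod N.

module _ (n : ℕ) where

  N : ℕ
  N = suc (suc (suc n))

  Vtx : Set
  Vtx = Fin N

  nxt : Vtx → Vtx
  nxt i = (toℕ i + 1) mod N

  prv : Vtx → Vtx
  prv i = (toℕ i + suc (suc n)) mod N

  -- Arcs of S_⊙: D i j (j ≠ i+1, possibly j = i) and central arcs D i 0.
  data Arc : Set where
    D   : (i j : Vtx) → .(j ≢ nxt i) → Arc
    Dc  : (i : Vtx) → Arc

  -- A frieze pattern of type D_N.  mb i j = m_{ij} (with m_{i,i+1} = 1),
  -- m0 i = m_{i0}.
  record Frieze : Set where
    field
      mb : Vtx → Vtx → ℕ
      m0 : Vtx → ℕ
      unit : ∀ i → mb i (nxt i) ≡ 1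
      pos-b : ∀ i j → j ≢ nxt i → 0 < mb i j
      pos-0 : ∀ i → 0 < m0 i
      R1 : ∀ i j → j ≢ prv i → j ≢ i → j ≢ nxt i →
           mb i j * mb (nxt i) (nxt j) ≡ mb (nxt i) j * mb i (nxt j) + 1
      R2 : ∀ i → mb i (prv i) * mb (nxt i) i ≡ mb (nxt i) (prv i) * mb i i * m0 i + 1
      R3 : ∀ i → mb i i * m0 (nxt i) ≡ mb (nxt i) i + 1
      R4 : ∀ i → m0 i * mb (nxt i) (nxt i) ≡ mb (nxt i) i + 1

  open Frieze public

  val : Frieze → Arc → ℕ
  val m (D i j _) = mb m i j
  val m (Dc i)    = m0 m i

  -- The arcs E_1,…,E_{N-2} are D_{p k, q k}
  -- for k : Fin (N-2) (index k corresponds to E_{k+1}); the last two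
  -- arcs are determined by the vertex i = p (last) and a choice among
  -- the four allowed pairs.
  data LastPair : Set where
    c-i c-i-1 c-00 c-ii : LastPair

  record Slice : Set where
    field
      a : Vtx
      p q : Fin (suc n) → Vtx
      start : p F.zero ≡ a × q F.zero ≡ nxt (nxt a)
      step  : ∀ (k : Fin n) →
              (p (F.suc k) ≡ p (inject₁ k) × q (F.suc k) ≡ nxt (q (inject₁ k)))
              ⊎ (p (F.suc k) ≡ prv (p (inject₁ k)) × q (F.suc k) ≡ q (inject₁ k))
      last  : LastPair

  open Slice public

  -- i where E_{N-2} = D_{i,i-1}
  sliceVertex : Slice → Vtx
  sliceVertex s = p s (fromℕ n)

  AgreeLast : Vtx → LastPair → Frieze → Frieze → Set
  AgreeLast i c-i   m m' = m0 m i ≡ m0 m' i × mb m i i ≡ mb m' i i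
  AgreeLast i c-i-1 m m' = m0 m (prv i) ≡ m0 m' (prv i) × mb m (prv i) (prv i) ≡ mb m' (prv i) (prv i)
  AgreeLast i c-00  m m' = m0 m i ≡ m0 m' i × m0 m (prv i) ≡ m0 m' (prv i)
  AgreeLast i c-ii  m m' = mb m i i ≡ mb m' i i × mb m (prv i) (prv i) ≡ mb m' (prv i) (prv i)

  AgreeOnSlice : Slice → Frieze → Frieze → Set
  AgreeOnSlice s m m' =
    (∀ k → mb m (p s k) (q s k) ≡ mb m' (p s k) (q s k))
    × AgreeLast (sliceVertex s) (last s) m m'

module Submission where

-- Every relation (R1)–(R4) reads a * b = r + 1, so each factor is determined by the other factor
-- and r, with no positivity needed. Walking along the slice, each arc E_{k+1} is the apex of a
-- triangle of the frieze array that extends the triangle under E_k by one row or one column, and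
-- the mesh relations (R1) fill in that row or column starting from the apex. The last triangle
-- contains the row of m_{ij} at the slice vertex i except m_{ii}; (R3) and (R4) at i - 1 recover
-- m_{ii} and m_{i0} from E_{N-1}, E_N. Finally (R1)–(R4) compute each row from the previous one.

open import Defs
open import Data.Nat using (ℕ; zero; suc; _+_; _*_; _∸_; _%_; _≤_; _<_; z≤n; s≤s; s≤s⁻¹; NonZero)
open import Data.Nat.Properties
open import Data.Nat.DivMod using (_mod_; %-distribˡ-+; m%n%n≡m%n; [m+n]%n≡m%n; m<n⇒m%n≡m; m%n<n)
open import Data.Fin using (Fin; toℕ; fromℕ; inject₁)
import Data.Fin as F
open import Data.Fin.Properties using (toℕ-fromℕ<; toℕ-injective; toℕ<n; toℕ-fromℕ; toℕ-inject₁)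
open import Data.Fin.Induction using (<-weakInduction)
open import Data.Product using (_×_; _,_; proj₁; proj₂; uncurry)
open import Data.Sum using (inj₁; inj₂)
open import Function using (_∘_)
open import Relation.Nullary using (contradiction)
open import Relation.Binary.PropositionalEquality

[m%n+o]%n≡[m+o]%n : ∀ m o n .{{_ : NonZero n}} → (m % n + o) % n ≡ (m + o) % n
[m%n+o]%n≡[m+o]%n m o n = begin
  (m % n + o) % n         ≡⟨ %-distribˡ-+ (m % n) o n ⟩
  (m % n % n + o % n) % n ≡⟨ cong (λ t → (t + o % n) % n) (m%n%n≡m%n m n) ⟩
  (m % n + o % n) % n     ≡⟨ %-distribˡ-+ m o n ⟨
  (m + o) % n             ∎
  where open ≡-Reasoning

*-cancelˡ-+1 : ∀ {a b b′ r} → a * b ≡ r + 1 → a * b′ ≡ r + 1 → b ≡ b′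
*-cancelˡ-+1 {zero}  {r = r} ab≡r+1 _ = contradiction (trans ab≡r+1 (+-comm r 1)) 0≢1+n
*-cancelˡ-+1 {suc a} {b} {b′} e e′ = *-cancelˡ-≡ b b′ (suc a) (trans e (sym e′))

exchange-determinesʳ : ∀ {a a′ b b′ r r′} → a * b ≡ r + 1 → a′ * b′ ≡ r′ + 1 →
                       a ≡ a′ → r ≡ r′ → b ≡ b′
exchange-determinesʳ {a} e e′ refl refl = *-cancelˡ-+1 {a} e e′

exchange-determinesˡ : ∀ {a a′ b b′ r r′} → a * b ≡ r + 1 → a′ * b′ ≡ r′ + 1 →
                       b ≡ b′ → r ≡ r′ → a ≡ a′
exchange-determinesˡ {a} {a′} {b} {b′} e e′ =
  exchange-determinesʳ (trans (*-comm b a) e) (trans (*-comm b′ a′) e′)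

<-weakInduction-toℕ : ∀ {n} (P : Fin (suc n) → ℕ → Set) → P F.zero 0 →
                      (∀ k → P (inject₁ k) (toℕ k) → P (F.suc k) (suc (toℕ k))) →
                      ∀ k → P k (toℕ k)
<-weakInduction-toℕ P P₀ Pₖ⇒Pₖ₊₁ = <-weakInduction (λ k → P k (toℕ k))
  P₀ (λ k → Pₖ⇒Pₖ₊₁ k ∘ subst (P (inject₁ k)) (toℕ-inject₁ k))

module Rotation (n : ℕ) where

  infixl 6 _⊕_
  _⊕_ : Vtx n → ℕ → Vtx n
  v ⊕ zero  = v
  v ⊕ suc k = nxt n v ⊕ k

  ⊕-+ : ∀ v a b → v ⊕ a ⊕ b ≡ v ⊕ (a + b)
  ⊕-+ v zero    b = refl
  ⊕-+ v (suc a) b = ⊕-+ (nxt n v) a b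

  nxt-⊕ : ∀ v k → nxt n (v ⊕ k) ≡ v ⊕ suc k
  nxt-⊕ v k = trans (⊕-+ v k 1) (cong (v ⊕_) (+-comm k 1))

  toℕ-mod : ∀ a → toℕ (a mod N n) ≡ a % N n
  toℕ-mod a = toℕ-fromℕ< _

  toℕ-⊕ : ∀ v k → toℕ (v ⊕ k) ≡ (toℕ v + k) % N n
  toℕ-⊕ v zero = sym (trans (cong (_% N n) (+-identityʳ (toℕ v))) (m<n⇒m%n≡m (toℕ<n v)))
  toℕ-⊕ v (suc k) = begin
    toℕ (nxt n v ⊕ k)             ≡⟨ toℕ-⊕ (nxt n v) k ⟩
    (toℕ (nxt n v) + k) % N n     ≡⟨ cong (λ t → (t + k) % N n) (toℕ-mod (toℕ v + 1)) ⟩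
    ((toℕ v + 1) % N n + k) % N n ≡⟨ [m%n+o]%n≡[m+o]%n (toℕ v + 1) k (N n) ⟩
    (toℕ v + 1 + k) % N n         ≡⟨ cong (_% N n) (+-assoc (toℕ v) 1 k) ⟩
    (toℕ v + suc k) % N n         ∎
    where open ≡-Reasoning

  prv≡⊕ : ∀ v → prv n v ≡ v ⊕ suc (suc n)
  prv≡⊕ v = toℕ-injective (trans (toℕ-mod (toℕ v + suc (suc n))) (sym (toℕ-⊕ v (suc (suc n)))))

  ⊕-N : ∀ v → v ⊕ N n ≡ v
  ⊕-N v = toℕ-injective (begin
    toℕ (v ⊕ N n)         ≡⟨ toℕ-⊕ v (N n) ⟩
    (toℕ v + N n) % N n   ≡⟨ [m+n]%n≡m%n (toℕ v) (N n) ⟩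
    toℕ v % N n           ≡⟨ m<n⇒m%n≡m (toℕ<n v) ⟩
    toℕ v                 ∎)
    where open ≡-Reasoning

  nxt-prv : ∀ v → nxt n (prv n v) ≡ v
  nxt-prv v = trans (cong (nxt n) (prv≡⊕ v)) (trans (nxt-⊕ v (suc (suc n))) (⊕-N v))

  offset : Vtx n → Vtx n → ℕ
  offset v w = (toℕ w + (N n ∸ toℕ v)) % N n

  offset<N : ∀ v w → offset v w < N n
  offset<N v w = m%n<n (toℕ w + (N n ∸ toℕ v)) (N n)

  private
    toℕ+complement : ∀ v → toℕ v + (N n ∸ toℕ v) ≡ N n
    toℕ+complement v = m+[n∸m]≡n (<⇒≤ (toℕ<n v))

  ⊕-offset : ∀ v w → v ⊕ offset v w ≡ w
  ⊕-offset v w = toℕ-injective (begin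
    toℕ (v ⊕ offset v w)                          ≡⟨ toℕ-⊕ v (offset v w) ⟩
    (toℕ v + (toℕ w + c) % N n) % N n             ≡⟨ cong (_% N n) (+-comm (toℕ v) _) ⟩
    ((toℕ w + c) % N n + toℕ v) % N n             ≡⟨ [m%n+o]%n≡[m+o]%n (toℕ w + c) (toℕ v) (N n) ⟩
    (toℕ w + c + toℕ v) % N n                     ≡⟨ cong (_% N n) w+c+v≡w+N ⟩
    (toℕ w + N n) % N n                           ≡⟨ [m+n]%n≡m%n (toℕ w) (N n) ⟩
    toℕ w % N n                                   ≡⟨ m<n⇒m%n≡m (toℕ<n w) ⟩
    toℕ w                                         ∎)
    where
    open ≡-Reasoning
    c = N n ∸ toℕ v
    w+c+v≡w+N : toℕ w + c + toℕ v ≡ toℕ w + N n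
    w+c+v≡w+N = trans (+-assoc (toℕ w) c (toℕ v))
                      (cong (toℕ w +_) (trans (+-comm c (toℕ v)) (toℕ+complement v)))

  offset-⊕ : ∀ v k → offset v (v ⊕ k) ≡ k % N n
  offset-⊕ v k = begin
    (toℕ (v ⊕ k) + c) % N n           ≡⟨ cong (λ t → (t + c) % N n) (toℕ-⊕ v k) ⟩
    ((toℕ v + k) % N n + c) % N n     ≡⟨ [m%n+o]%n≡[m+o]%n (toℕ v + k) c (N n) ⟩
    (toℕ v + k + c) % N n             ≡⟨ cong (λ t → (t + c) % N n) (+-comm (toℕ v) k) ⟩
    (k + toℕ v + c) % N n             ≡⟨ cong (_% N n) (+-assoc k (toℕ v) c) ⟩
    (k + (toℕ v + c)) % N n           ≡⟨ cong (λ t → (k + t) % N n) (toℕ+complement v) ⟩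
    (k + N n) % N n                   ≡⟨ [m+n]%n≡m%n k (N n) ⟩
    k % N n                           ∎
    where
    open ≡-Reasoning
    c = N n ∸ toℕ v

  ⊕-injective : ∀ v {k l} → k < N n → l < N n → v ⊕ k ≡ v ⊕ l → k ≡ l
  ⊕-injective v {k} {l} k<N l<N eq = begin
    k               ≡⟨ m<n⇒m%n≡m k<N ⟨
    k % N n         ≡⟨ offset-⊕ v k ⟨
    offset v (v ⊕ k) ≡⟨ cong (offset v) eq ⟩
    offset v (v ⊕ l) ≡⟨ offset-⊕ v l ⟩
    l % N n         ≡⟨ m<n⇒m%n≡m l<N ⟩
    l               ∎
    where open ≡-Reasoning

  ⊕-≢-neighbours : ∀ u {d} → 2 ≤ d → d ≤ suc n →
                   u ⊕ d ≢ prv n u × u ⊕ d ≢ u × u ⊕ d ≢ nxt n u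
  ⊕-≢-neighbours u {d} 2≤d d≤1+n =
      (λ e → <-irrefl (⊕-injective u d<N ≤-refl (trans e (prv≡⊕ u))) (s≤s d≤1+n))
    , (λ e → contradiction (subst (2 ≤_) (⊕-injective u d<N (s≤s z≤n) e) 2≤d) λ ())
    , (λ e → contradiction (subst (2 ≤_) (⊕-injective u d<N (s≤s (s≤s z≤n)) e) 2≤d) λ { (s≤s ()) })
    where
    d<N : d < N n
    d<N = s≤s (m≤n⇒m≤1+n d≤1+n)

module Relations (n : ℕ) (F : Frieze n) where
  open Rotation n

  unit-⊕ : ∀ v x → mb F (v ⊕ x) (v ⊕ suc x) ≡ 1
  unit-⊕ v x = subst (λ w → mb F (v ⊕ x) w ≡ 1) (nxt-⊕ v x) (unit F (v ⊕ x))

  mesh : ∀ v {x y} → 2 + x ≤ y → y ≤ x + suc n →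
         mb F (v ⊕ x) (v ⊕ y) * mb F (v ⊕ suc x) (v ⊕ suc y)
           ≡ mb F (v ⊕ suc x) (v ⊕ y) * mb F (v ⊕ x) (v ⊕ suc y) + 1
  mesh v {x} {y} 2+x≤y y≤x+1+n =
    subst₂ (λ u w → mb F (v ⊕ x) (v ⊕ y) * mb F u w ≡ mb F u (v ⊕ y) * mb F (v ⊕ x) w + 1)
      (nxt-⊕ v x) (nxt-⊕ v y)
      (R1 F (v ⊕ x) (v ⊕ y) (≢prv ∘ via-d) (≢self ∘ via-d) (≢nxt ∘ via-d))
    where
    d = y ∸ x
    v⊕x⊕d≡v⊕y : v ⊕ x ⊕ d ≡ v ⊕ y
    v⊕x⊕d≡v⊕y = trans (⊕-+ v x d) (cong (v ⊕_) (m+[n∸m]≡n (m+n≤o⇒n≤o 2 2+x≤y)))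
    via-d : ∀ {w} → v ⊕ y ≡ w → v ⊕ x ⊕ d ≡ w
    via-d = trans v⊕x⊕d≡v⊕y
    neighbours : v ⊕ x ⊕ d ≢ prv n (v ⊕ x) × v ⊕ x ⊕ d ≢ v ⊕ x × v ⊕ x ⊕ d ≢ nxt n (v ⊕ x)
    neighbours = ⊕-≢-neighbours (v ⊕ x) (m+n≤o⇒m≤o∸n 2 2+x≤y) (m≤n+o⇒m∸n≤o y x y≤x+1+n)
    ≢prv = proj₁ neighbours
    ≢self = proj₁ (proj₂ neighbours)
    ≢nxt = proj₂ (proj₂ neighbours)

  R3-at-prv : ∀ v → mb F (prv n v) (prv n v) * m0 F v ≡ mb F v (prv n v) + 1
  R3-at-prv v = subst (λ u → mb F (prv n v) (prv n v) * m0 F u ≡ mb F u (prv n v) + 1)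
                      (nxt-prv v) (R3 F (prv n v))

  R4-at-prv : ∀ v → m0 F (prv n v) * mb F v v ≡ mb F v (prv n v) + 1
  R4-at-prv v = subst (λ u → m0 F (prv n v) * mb F u u ≡ mb F u (prv n v) + 1)
                      (nxt-prv v) (R4 F (prv n v))

module SliceGeometry (n : ℕ) (s : Slice n) where
  open Rotation n

  q≡p⊕[2+k] : ∀ k → q s k ≡ p s k ⊕ (2 + toℕ k)
  q≡p⊕[2+k] = <-weakInduction-toℕ (λ k t → q s k ≡ p s k ⊕ (2 + t)) base step′
    where
    base : q s F.zero ≡ p s F.zero ⊕ 2
    base = trans (proj₂ (start s)) (cong (_⊕ 2) (sym (proj₁ (start s))))
    step′ : ∀ k → q s (inject₁ k) ≡ p s (inject₁ k) ⊕ (2 + toℕ k) →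
            q s (F.suc k) ≡ p s (F.suc k) ⊕ (3 + toℕ k)
    step′ k ih with step s k
    ... | inj₁ (p≡ , q≡) = begin
      q s (F.suc k)                         ≡⟨ q≡ ⟩
      nxt n (q s (inject₁ k))               ≡⟨ cong (nxt n) ih ⟩
      nxt n (p s (inject₁ k) ⊕ (2 + toℕ k)) ≡⟨ nxt-⊕ (p s (inject₁ k)) (2 + toℕ k) ⟩
      p s (inject₁ k) ⊕ (3 + toℕ k)         ≡⟨ cong (_⊕ (3 + toℕ k)) p≡ ⟨
      p s (F.suc k) ⊕ (3 + toℕ k)           ∎
      where open ≡-Reasoning
    ... | inj₂ (p≡ , q≡) = begin
      q s (F.suc k)                                 ≡⟨ q≡ ⟩
      q s (inject₁ k)                               ≡⟨ ih ⟩
      p s (inject₁ k) ⊕ (2 + toℕ k)                 ≡⟨ cong (_⊕ (2 + toℕ k)) (nxt-prv (p s (inject₁ k))) ⟨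
      nxt n (prv n (p s (inject₁ k))) ⊕ (2 + toℕ k) ≡⟨ cong (_⊕ (3 + toℕ k)) p≡ ⟨
      p s (F.suc k) ⊕ (3 + toℕ k)                   ∎
      where open ≡-Reasoning

module Agreement (n : ℕ) (m m′ : Frieze n) where
  open Rotation n
  open Relations n

  Agree : Vtx n → Vtx n → Set
  Agree u w = mb m u w ≡ mb m′ u w

  Agree⊕ : Vtx n → ℕ → ℕ → Set
  Agree⊕ v x y = Agree (v ⊕ x) (v ⊕ y)

  unit-agrees : ∀ v x → Agree⊕ v x (suc x)
  unit-agrees v x = trans (unit-⊕ m v x) (sym (unit-⊕ m′ v x))

  mesh-forward : ∀ v {x y} → 2 + x ≤ y → y ≤ x + suc n →
                 Agree⊕ v x y → Agree⊕ v (suc x) y → Agree⊕ v x (suc y) → Agree⊕ v (suc x) (suc y)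
  mesh-forward v h h′ a b c =
    exchange-determinesʳ (mesh m v h h′) (mesh m′ v h h′) a (cong₂ _*_ b c)

  mesh-backward : ∀ v {x y} → 2 + x ≤ y → y ≤ x + suc n →
                  Agree⊕ v (suc x) (suc y) → Agree⊕ v (suc x) y → Agree⊕ v x (suc y) → Agree⊕ v x y
  mesh-backward v h h′ d b c =
    exchange-determinesˡ (mesh m v h h′) (mesh m′ v h h′) d (cong₂ _*_ b c)

  -- The triangle of the frieze array with apex m_{v,v+ℓ}.
  Triangle : Vtx n → ℕ → Set
  Triangle v ℓ = ∀ {x y} → x < y → y ≤ ℓ → Agree⊕ v x y

  triangle-0 : ∀ {v} → Triangle v 0
  triangle-0 {y = zero}  () _
  triangle-0 {y = suc _} _ ()

  extend-right : ∀ {v ℓ} → ℓ ≤ suc n → Triangle v ℓ → Agree⊕ v 0 (suc ℓ) → Triangle v (suc ℓ)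
  extend-right {v} {ℓ} ℓ≤1+n tri apex {x} {y} x<y y≤1+ℓ with m≤n⇒m<n∨m≡n y≤1+ℓ
  ... | inj₁ y<1+ℓ = tri x<y (s≤s⁻¹ y<1+ℓ)
  ... | inj₂ refl  = column x (s≤s⁻¹ x<y)
    where
    column : ∀ x → x ≤ ℓ → Agree⊕ v x (suc ℓ)
    column zero    _       = apex
    column (suc x) 1+x≤ℓ with m≤n⇒m<n∨m≡n 1+x≤ℓ
    ... | inj₂ refl  = unit-agrees v (suc x)
    ... | inj₁ 2+x≤ℓ =
      mesh-forward v 2+x≤ℓ (≤-trans ℓ≤1+n (m≤n+m (suc n) x))
        (tri (<⇒≤ 2+x≤ℓ) ≤-refl) (tri 2+x≤ℓ ≤-refl) (column x (<⇒≤ 1+x≤ℓ))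

  extend-left : ∀ {v ℓ} → ℓ ≤ suc n → Triangle (nxt n v) ℓ → Agree⊕ v 0 (suc ℓ) → Triangle v (suc ℓ)
  extend-left {v} {ℓ} ℓ≤1+n tri apex {suc x} {suc y} (s≤s x<y) (s≤s y≤ℓ) = tri x<y y≤ℓ
  extend-left {v} {ℓ} ℓ≤1+n tri apex {zero}  {y}     0<y       y≤1+ℓ     =
    row (suc ℓ ∸ y) (m∸n+n≡m y≤1+ℓ) 0<y
    where
    row : ∀ g {y} → g + y ≡ suc ℓ → 0 < y → Agree⊕ v 0 y
    row zero    refl _ = apex
    row (suc g) {suc zero}    _  _ = unit-agrees v 0
    row (suc g) {suc (suc y)} eq _ =
      mesh-backward v (s≤s (s≤s z≤n)) (≤-trans 2+y≤ℓ ℓ≤1+n)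
        (tri (s≤s z≤n) 2+y≤ℓ) (tri (s≤s z≤n) (<⇒≤ 2+y≤ℓ))
        (row g (trans (+-suc g (2 + y)) eq) (s≤s z≤n))
      where
      2+y≤ℓ : 2 + y ≤ ℓ
      2+y≤ℓ = subst (2 + y ≤_) (suc-injective eq) (m≤n+m (2 + y) g)

  slice-triangle : (s : Slice n) → (∀ k → Agree (p s k) (q s k)) →
                   ∀ k → Triangle (p s k) (2 + toℕ k)
  slice-triangle s on-slice = <-weakInduction-toℕ (λ k t → Triangle (p s k) (2 + t)) base step′
    where
    open SliceGeometry n s
    apex : ∀ k → Agree⊕ (p s k) 0 (2 + toℕ k)
    apex k = subst (Agree (p s k)) (q≡p⊕[2+k] k) (on-slice k)
    base : Triangle (p s F.zero) 2
    base = extend-right (s≤s z≤n) (extend-right z≤n triangle-0 (unit-agrees _ 0)) (apex F.zero)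
    step′ : ∀ k → Triangle (p s (inject₁ k)) (2 + toℕ k) → Triangle (p s (F.suc k)) (3 + toℕ k)
    step′ k ih with step s k
    ... | inj₁ (p≡ , _) =
      extend-right (s≤s (toℕ<n k)) (subst (λ u → Triangle u (2 + toℕ k)) (sym p≡) ih) (apex (F.suc k))
    ... | inj₂ (p≡ , _) =
      extend-left (s≤s (toℕ<n k)) (subst (λ u → Triangle u (2 + toℕ k)) p≡nxt ih) (apex (F.suc k))
      where
      p≡nxt : p s (inject₁ k) ≡ nxt n (p s (F.suc k))
      p≡nxt = sym (trans (cong (nxt n) p≡) (nxt-prv _))

  RowAgrees : Vtx n → Set
  RowAgrees v = (∀ w → Agree v w) × m0 m v ≡ m0 m′ v

  row-agrees : ∀ v → (∀ {y} → 0 < y → y ≤ 2 + n → Agree v (v ⊕ y)) →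
               Agree v v → m0 m v ≡ m0 m′ v → RowAgrees v
  row-agrees v off diagonal central =
    (λ w → subst (Agree v) (⊕-offset v w) (at (offset<N v w))) , central
    where
    at : ∀ {k} → k < N n → Agree v (v ⊕ k)
    at {zero}  _          = diagonal
    at {suc k} (s≤s k<N) = off (s≤s z≤n) k<N

  row-step : ∀ v → RowAgrees v → RowAgrees (nxt n v)
  row-step v (row , central) = row-agrees (nxt n v) off diagonal′ central′
    where
    next : ∀ {y} → 0 < y → y ≤ suc n → Agree⊕ v 1 (suc y)
    next {suc zero}    _ _     = unit-agrees v 1
    next {suc (suc y)} _ y≤1+n =
      mesh-forward v (s≤s (s≤s z≤n)) y≤1+n (row _) (next (s≤s z≤n) (<⇒≤ y≤1+n)) (row _)
    to-prv : Agree (nxt n v) (prv n v)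
    to-prv = subst (Agree (nxt n v)) (sym (prv≡⊕ v)) (next (s≤s z≤n) ≤-refl)
    to-self : Agree (nxt n v) v
    to-self = exchange-determinesʳ (R2 m v) (R2 m′ v) (row (prv n v))
                (cong₂ _*_ (cong₂ _*_ to-prv (row v)) central)
    diagonal′ : Agree (nxt n v) (nxt n v)
    diagonal′ = exchange-determinesʳ (R4 m v) (R4 m′ v) central to-self
    central′ : m0 m (nxt n v) ≡ m0 m′ (nxt n v)
    central′ = exchange-determinesʳ (R3 m v) (R3 m′ v) (row v) to-self
    off : ∀ {y} → 0 < y → y ≤ 2 + n → Agree (nxt n v) (nxt n v ⊕ y)
    off 0<y y≤2+n with m≤n⇒m<n∨m≡n y≤2+n
    ... | inj₁ y<2+n = next 0<y (s≤s⁻¹ y<2+n)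
    ... | inj₂ refl  = subst (Agree (nxt n v)) (sym (⊕-N v)) to-self

  row-propagates : ∀ v k → RowAgrees v → RowAgrees (v ⊕ k)
  row-propagates v zero    r = r
  row-propagates v (suc k) r = row-propagates (nxt n v) k (row-step v r)

  last-pair : ∀ v c → Agree v (prv n v) → AgreeLast n v c m m′ → Agree v v × m0 m v ≡ m0 m′ v
  last-pair v c-i   _    (central , diagonal)   = diagonal , central
  last-pair v c-i-1 to-p (central-p , diagonal-p) =
      exchange-determinesʳ (R4-at-prv m v) (R4-at-prv m′ v) central-p to-p
    , exchange-determinesʳ (R3-at-prv m v) (R3-at-prv m′ v) diagonal-p to-p
  last-pair v c-00  to-p (central , central-p)  =
    exchange-determinesʳ (R4-at-prv m v) (R4-at-prv m′ v) central-p to-p , central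
  last-pair v c-ii  to-p (diagonal , diagonal-p) =
    diagonal , exchange-determinesʳ (R3-at-prv m v) (R3-at-prv m′ v) diagonal-p to-p

  slice-vertex-row : (s : Slice n) → AgreeOnSlice n s m m′ → RowAgrees (sliceVertex n s)
  slice-vertex-row s (on-slice , on-last) =
    uncurry (row-agrees i (λ 0<y y≤2+n → tri 0<y y≤2+n))
      (last-pair i (last s) (subst (Agree i) (sym (prv≡⊕ i)) (tri (s≤s z≤n) ≤-refl)) on-last)
    where
    i = sliceVertex n s
    tri : Triangle i (2 + n)
    tri = subst (λ t → Triangle i (2 + t)) (toℕ-fromℕ n) (slice-triangle s on-slice (fromℕ n))

  every-row-agrees : ∀ {v} → RowAgrees v → ∀ w → RowAgrees w
  every-row-agrees {v} r w = subst RowAgrees (⊕-offset v w) (row-propagates v (offset v w) r)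

  arc-agrees : (∀ v → RowAgrees v) → ∀ E → val n m E ≡ val n m′ E
  arc-agrees rows (D v w _) = proj₁ (rows v) w
  arc-agrees rows (Dc v)    = proj₂ (rows v)

lemma6p5 : (n : ℕ) (m m' : Frieze n) (s : Slice n) →
    AgreeOnSlice n s m m' → (E : Arc n) → val n m E ≡ val n m' E
lemma6p5 n m m' s on-slice = arc-agrees (every-row-agrees (slice-vertex-row s on-slice))
  where open Agreement n m m'
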